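{- Let $G=(V,E)$ be an $s$-$t$ graph and let $x_{uv}\in\mathbb{Z}_{\ge0}$, $uv\in E$, be nonnegative integers satisfying, for every $v\in V$, $$\sum_{uv\in E}x_{uv}-\sum_{vw\in E}x_{vw}=\begin{cases}-1 & v=s,\\ 1 & v=t,\\ 0&\text{otherwise.}\end{cases}$$ Let $M_1$ be a constant with $M_1\ge \sum_{wv\in E}x_{wv}$ for every $v\in V$ (e.g. $M_1 = \max_v d^-(v)\cdot\max_{e\in E}x_e$, $d^-(v)$ the in-degree of $v$), and $M_2\ge |V|$. Then there exists an $s$-$t$ walk $W$ in $G$ such that $W(uv)=x_{uv}$ for every edge $uv\in E$ if and only if there exist binary variables $y_{uv}\in\{0,1\}$ ($uv\in E$) and integers $d_v\in\mathbb{Z}_{\ge0}$ ($v\in V$) with $d_s=0$ satisfying (i) $y_{uv}\le x_{uv}$ for all $uv\in E$; (ii) $\sum_{wv\in E}x_{wv}\le M_1\sum_{wv\in E}y_{wv}$ for all $v\in V$; (iii) $\sum_{wv\in E}y_{wv}\le 1$ for all $v\in V$; (iv) $d_v\ge d_u+1-M_2(1-y_{uv})$ for all $uv\in E$.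
   Context: An $s$-$t$ graph is a directed graph without parallel edges (self-loops allowed) with a unique source $s$ (no incoming edges) and a unique sink $t$ (no outgoing edges). An $s$-$t$ walk is a sequence of vertices starting at $s$ and ending at $t$ with consecutive vertices joined by edges (vertices and edges may repeat). For a walk $W$ and an edge $uv$, $W(uv)$ denotes the number of times $W$ traverses $uv$ (0 if never). -}

module Defs where

open import Data.Nat using (ℕ; zero; suc; _+_)
open import Data.Bool using (Bool; true; false; if_then_else_)
open import Data.Fin using (Fin; _≟_)
open import Data.List using (List; map; allFin)
open import Data.Nat.ListAction using (sum)
open import Data.Product using (Σ; _×_)
open import Relation.Binary.PropositionalEquality using (_≡_)
open import Relation.Nullary using (¬_; does)

-- A directed graph without parallel edges (self-loops allowed) on the vertex
-- set Fin n is given by its adjacency relation: uv ∈ E  iff  E u v ≡ true.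
Graph : ℕ → Set
Graph n = Fin n → Fin n → Bool

Edge : ∀ {n} → Graph n → Fin n → Fin n → Set
Edge E u v = E u v ≡ true

∑ : ∀ {n} → (Fin n → ℕ) → ℕ
∑ {n} f = sum (map f (allFin n))

onEdges : ∀ {n} → Graph n → (Fin n → Fin n → ℕ) → Fin n → Fin n → ℕ
onEdges E x u v = if E u v then x u v else 0

inSum : ∀ {n} → Graph n → (Fin n → Fin n → ℕ) → Fin n → ℕ
inSum E x v = ∑ (λ w → onEdges E x w v)

outSum : ∀ {n} → Graph n → (Fin n → Fin n → ℕ) → Fin n → ℕ
outSum E x v = ∑ (λ w → onEdges E x v w)

HasIn : ∀ {n} → Graph n → Fin n → Set
HasIn {n} E v = Σ (Fin n) (λ u → Edge E u v)

HasOut : ∀ {n} → Graph n → Fin n → Set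
HasOut {n} E v = Σ (Fin n) (λ w → Edge E v w)

record IsSTGraph {n} (E : Graph n) (s t : Fin n) : Set where
  field
    s-source    : ¬ HasIn E s
    t-sink      : ¬ HasOut E t
    source-uniq : ∀ v → ¬ HasIn E v → v ≡ s
    sink-uniq   : ∀ v → ¬ HasOut E v → v ≡ t

data WalkTo {n} (E : Graph n) (t : Fin n) : Fin n → Set where
  done : WalkTo E t t
  step : ∀ {u v} → Edge E u v → WalkTo E t v → WalkTo E t u

traversals : ∀ {n} {E : Graph n} {t u : Fin n} → WalkTo E t u → Fin n → Fin n → ℕ
traversals done a b = 0
traversals (step {u} {v} _ w) a b =
  (if does (u ≟ a) then (if does (v ≟ b) then 1 else 0) else 0) + traversals w a b

open import Data.Integer using (ℤ; +_; -_)

flowDemand : ∀ {n} → Fin n → Fin n → Fin n → ℤ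
flowDemand s t v =
  if does (v ≟ s) then - (+ 1) else (if does (v ≟ t) then + 1 else + 0)

{-# OPTIONS --safe #-}
module Submission where

-- A walk W from s to t determines the edges y by which it enters each vertex for the first time,
-- and the potential d = rank of the time of that first visit. Entry edges are traversed and go up
-- in d, and every vertex other than s that W reaches has exactly one of them, which gives (i)–(iv);
-- since d < n ≤ M₂, constraint (iv) is void on unmarked edges.
--
-- Conversely, (i), (ii) and (iv) say that every vertex carrying flow is entered, along an edge of
-- positive flow, from a vertex of smaller d. Build the walk backwards from t: remove one unit of
-- flow from an edge ct into the current end t, taking the lower entry of t only when no other edge
-- into t carries flow. This keeps the property, and what is left is a unit flow from s to c. When
-- no flow enters the current end, the end is s and what is left is a circulation, which the
-- property forces to vanish.

open import Defs
open import Algebra.Properties.CommutativeSemigroup using (interchange; xy∙z≈xz∙y)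
open import Data.Bool using (Bool; true; false; if_then_else_)
open import Data.Bool.Properties using (T-≡) renaming (_≟_ to _≟ᵇ_)
open import Data.Fin using (Fin; zero; suc; _≟_)
open import Data.Fin.Properties using (any?) renaming (suc-injective to suc-injectiveᶠ)
open import Data.Fin.Subset using (Subset; _∈_; ∣_∣)
open import Data.Fin.Subset.Properties
  using (p⊂q⇒∣p∣<∣q∣; ∣⊤∣≡n; ∣⊥∣≡0; ⊆⊤; ∈⊤; Empty-unique)
open import Data.Integer using (+_; _-_; +≤+)
  renaming (_+_ to _+ℤ_; _*_ to _*ℤ_; _≤_ to _≤ℤ_)
import Data.Integer.Properties as ℤ
open import Data.Integer.Tactic.RingSolver using (solve-∀)
open import Data.List using (map; allFin)
open import Data.List.Properties using (map-tabulate; map-cong)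
open import Data.Maybe using (Maybe; just; nothing)
open import Data.Maybe.Properties using (≡-dec; just-injective)
open import Data.Nat
  using (ℕ; zero; suc; _+_; _*_; _∸_; _≤_; _<_; _<ᵇ_; z≤n; s≤s; s≤s⁻¹; _<?_; >-nonZero)
open import Data.Nat.ListAction using (sum)
open import Data.Nat.Properties renaming (_≟_ to _≟ℕ_)
open import Data.Product using (Σ; ∃; _×_; _,_; proj₁; proj₂)
import Data.Vec as Vec
open import Data.Vec.Properties using (lookup∘tabulate; lookup⇒[]=; []=⇒lookup)
open import Function using (_∘_; id; _⇔_; mk⇔; Equivalence)
open import Relation.Binary.PropositionalEquality
open import Relation.Nullary using (Dec; yes; no; does; ¬_; contradiction)
open import Relation.Nullary.Decidable using (dec-true; dec-false; _×-dec_; ¬?)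

𝟙 : ∀ {p} {P : Set p} → Dec P → ℕ
𝟙 P? = if does P? then 1 else 0

module _ {p} {P : Set p} where

  𝟙-yes : (P? : Dec P) → P → 𝟙 P? ≡ 1
  𝟙-yes P? x rewrite dec-true P? x = refl

  𝟙-no : (P? : Dec P) → ¬ P → 𝟙 P? ≡ 0
  𝟙-no P? ¬x rewrite dec-false P? ¬x = refl

  𝟙≤ : (P? : Dec P) {k : ℕ} → (P → 0 < k) → 𝟙 P? ≤ k
  𝟙≤ (yes x) k>0 = k>0 x
  𝟙≤ (no _) _ = z≤n

  𝟙≤1 : (P? : Dec P) → 𝟙 P? ≤ 1
  𝟙≤1 P? = 𝟙≤ P? (λ _ → s≤s z≤n)

  𝟙-positive : (P? : Dec P) → 0 < 𝟙 P? → P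
  𝟙-positive (yes x) _ = x

_≟ₘ_ : ∀ {n} → (a b : Maybe (Fin n)) → Dec (a ≡ b)
_≟ₘ_ = ≡-dec _≟_

δ : ∀ {n} → Fin n → Fin n → ℕ
δ a b = 𝟙 (a ≟ b)

-- Written so that traversals (step {c} {t} _ W) u v reduces to edgeδ c t u v + traversals W u v.
edgeδ : ∀ {n} → Fin n → Fin n → Fin n → Fin n → ℕ
edgeδ c t u v = if does (c ≟ u) then δ t v else 0

module _ {n : ℕ} where

  edgeδ-off-tail : ∀ {c u : Fin n} t v → c ≢ u → edgeδ c t u v ≡ 0
  edgeδ-off-tail {c} {u} t v c≢u rewrite dec-false (c ≟ u) c≢u = refl

  edgeδ-off-head : ∀ (c u : Fin n) {t v} → t ≢ v → edgeδ c t u v ≡ 0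
  edgeδ-off-head c u {t} {v} t≢v with c ≟ u
  ... | yes _ = 𝟙-no (t ≟ v) t≢v
  ... | no _ = refl

∑-suc : ∀ {n} (f : Fin (suc n) → ℕ) → ∑ f ≡ f zero + ∑ (f ∘ suc)
∑-suc f = cong (λ l → f zero + sum l)
               (trans (map-tabulate suc f) (sym (map-tabulate id (f ∘ suc))))

∑-cong : ∀ {n} {f g : Fin n → ℕ} → (∀ i → f i ≡ g i) → ∑ f ≡ ∑ g
∑-cong f≗g = cong sum (map-cong f≗g (allFin _))

∑-distrib-+ : ∀ {n} (f g : Fin n → ℕ) → ∑ (λ i → f i + g i) ≡ ∑ f + ∑ g
∑-distrib-+ {zero} f g = refl
∑-distrib-+ {suc n} f g = begin
  ∑ (λ i → f i + g i)
    ≡⟨ ∑-suc (λ i → f i + g i) ⟩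
  (f zero + g zero) + ∑ (λ i → f (suc i) + g (suc i))
    ≡⟨ cong (_+_ (f zero + g zero)) (∑-distrib-+ (f ∘ suc) (g ∘ suc)) ⟩
  (f zero + g zero) + (∑ (f ∘ suc) + ∑ (g ∘ suc))
    ≡⟨ interchange +-commutativeSemigroup (f zero) (g zero) _ _ ⟩
  (f zero + ∑ (f ∘ suc)) + (g zero + ∑ (g ∘ suc))
    ≡⟨ sym (cong₂ _+_ (∑-suc f) (∑-suc g)) ⟩
  ∑ f + ∑ g ∎
  where open ≡-Reasoning

∑-zero : ∀ {n} {f : Fin n → ℕ} → (∀ i → f i ≡ 0) → ∑ f ≡ 0
∑-zero {zero} f≗0 = refl
∑-zero {suc n} {f} f≗0 = trans (∑-suc f) (cong₂ _+_ (f≗0 zero) (∑-zero (f≗0 ∘ suc)))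

∑-single : ∀ {n} {f : Fin n → ℕ} (c : Fin n) → (∀ i → i ≢ c → f i ≡ 0) → ∑ f ≡ f c
∑-single {suc n} {f} zero f≗0 =
  trans (∑-suc f) (trans (cong (_+_ (f zero)) (∑-zero (λ i → f≗0 (suc i) λ ()))) (+-identityʳ _))
∑-single {suc n} {f} (suc c) f≗0 =
  trans (∑-suc f) (cong₂ _+_ (f≗0 zero λ ()) (∑-single c (λ i i≢c → f≗0 (suc i) (i≢c ∘ suc-injectiveᶠ))))

∑-δ : ∀ {n} (c : Fin n) (k : ℕ) → ∑ (λ i → if does (c ≟ i) then k else 0) ≡ k
∑-δ c k = trans (∑-single c (λ i i≢c → cong pick (dec-false (c ≟ i) (i≢c ∘ sym))))
                (cong pick (dec-true (c ≟ c) refl))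
  where
  pick : Bool → ℕ
  pick b = if b then k else 0

∑-edgeδ-head : ∀ {n} (c t v : Fin n) → ∑ (λ u → edgeδ c t u v) ≡ δ t v
∑-edgeδ-head c t v = ∑-δ c (δ t v)

∑-edgeδ-tail : ∀ {n} (c t u : Fin n) → ∑ (λ v → edgeδ c t u v) ≡ δ c u
∑-edgeδ-tail {n} c t u with c ≟ u
... | yes _ = ∑-δ t 1
... | no _ = ∑-zero {n} {λ _ → 0} (λ _ → refl)

∑-𝟙-just : ∀ {n} (m : Maybe (Fin n)) → ∑ (λ u → 𝟙 (m ≟ₘ just u)) ≤ 1
∑-𝟙-just {n} nothing = subst (_≤ 1) (sym (∑-zero {n} {λ _ → 0} (λ _ → refl))) z≤n
∑-𝟙-just (just p) = ≤-reflexive (trans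
  (∑-single p (λ u u≢p → 𝟙-no (just p ≟ₘ just u) (u≢p ∘ sym ∘ just-injective)))
  (𝟙-yes (just p ≟ₘ just p) refl))

∑-mono : ∀ {n} {f g : Fin n → ℕ} → (∀ i → f i ≤ g i) → ∑ f ≤ ∑ g
∑-mono {zero} _ = z≤n
∑-mono {suc n} {f} {g} f≤g =
  subst₂ _≤_ (sym (∑-suc f)) (sym (∑-suc g)) (+-mono-≤ (f≤g zero) (∑-mono (f≤g ∘ suc)))

term≤∑ : ∀ {n} (f : Fin n → ℕ) (c : Fin n) → f c ≤ ∑ f
term≤∑ f zero = subst (f zero ≤_) (sym (∑-suc f)) (m≤m+n _ _)
term≤∑ f (suc c) = subst (f (suc c) ≤_) (sym (∑-suc f)) (≤-trans (term≤∑ (f ∘ suc) c) (m≤n+m _ _))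

∑-positive : ∀ {n} {f : Fin n → ℕ} → 0 < ∑ f → ∃ λ i → 0 < f i
∑-positive {f = f} ∑f>0 with any? (λ i → 0 <? f i)
... | yes found = found
... | no none = contradiction (∑-zero (λ i → n≤0⇒n≡0 (≮⇒≥ (λ fi>0 → none (i , fi>0)))))
                              (n>0⇒n≢0 ∑f>0)

bigM-support⁺ : ∀ {a b M} → a ≤ M → (0 < a → 0 < b) → a ≤ M * b
bigM-support⁺ {zero} _ _ = z≤n
bigM-support⁺ {suc a} {b} {M} a≤M support =
  ≤-trans a≤M (m≤m*n M b {{>-nonZero (support (s≤s z≤n))}})

bigM-support⁻ : ∀ {a b} M → a ≤ M * b → 0 < a → 0 < b
bigM-support⁻ {b = zero} M a≤M*0 a>0 =
  contradiction (<-≤-trans a>0 (≤-trans a≤M*0 (≤-reflexive (*-zeroʳ M)))) n≮0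
bigM-support⁻ {b = suc b} _ _ _ = s≤s z≤n

i-o≡k-m⇒i+m≡o+k : ∀ i o k m → + i - + o ≡ + k - + m → i + m ≡ o + k
i-o≡k-m⇒i+m≡o+k i o k m eq = ℤ.+-injective (begin
  + i +ℤ + m                  ≡⟨ regroup (+ i) (+ o) (+ m) ⟩
  (+ i - + o) +ℤ (+ o +ℤ + m) ≡⟨ cong (_+ℤ (+ o +ℤ + m)) eq ⟩
  (+ k - + m) +ℤ (+ o +ℤ + m) ≡⟨ cancel (+ k) (+ m) (+ o) ⟩
  + o +ℤ + k                  ∎)
  where
  open ≡-Reasoning
  regroup : ∀ a b c → a +ℤ c ≡ (a - b) +ℤ (b +ℤ c)
  regroup = solve-∀
  cancel : ∀ a b c → (a - b) +ℤ (c +ℤ b) ≡ c +ℤ a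
  cancel = solve-∀

bigM-active-≡ : ∀ {a M} → (+ a) +ℤ + 1 - (+ M) *ℤ (+ 1 - + 1) ≡ + suc a
bigM-active-≡ {a} {M} = trans (cong (λ z → (+ a) +ℤ + 1 - z) (ℤ.*-zeroʳ (+ M)))
                              (cong +_ (trans (+-identityʳ (a + 1)) (+-comm a 1)))

bigM-active⁺ : ∀ {a b M} → a < b → (+ a) +ℤ + 1 - (+ M) *ℤ (+ 1 - + 1) ≤ℤ + b
bigM-active⁺ {a} {b} {M} a<b = subst (_≤ℤ + b) (sym (bigM-active-≡ {a} {M})) (+≤+ a<b)

bigM-active⁻ : ∀ {a b M} → (+ a) +ℤ + 1 - (+ M) *ℤ (+ 1 - + 1) ≤ℤ + b → a < b
bigM-active⁻ {a} {b} {M} ineq = ℤ.drop‿+≤+ (subst (_≤ℤ + b) (bigM-active-≡ {a} {M}) ineq)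

bigM-inactive : ∀ {a b M} → a < M → (+ a) +ℤ + 1 - (+ M) *ℤ (+ 1 - + 0) ≤ℤ + b
bigM-inactive {a} {b} {M} a<M rewrite ℤ.*-identityʳ (+ M) =
  ℤ.≤-trans (ℤ.i≤j⇒i-j≤0 (+≤+ (subst (_≤ M) (+-comm 1 a) a<M))) (+≤+ z≤n)

module _ {n : ℕ} (f : Fin n → ℕ) where

  below : ℕ → Subset n
  below k = Vec.tabulate (λ w → f w <ᵇ k)

  ∈-below⁺ : ∀ {w k} → f w < k → w ∈ below k
  ∈-below⁺ {w} fw<k =
    lookup⇒[]= w _ (trans (lookup∘tabulate _ w) (Equivalence.to T-≡ (<⇒<ᵇ fw<k)))

  ∈-below⁻ : ∀ {w k} → w ∈ below k → f w < k
  ∈-below⁻ {w} {k} w∈ =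
    <ᵇ⇒< (f w) k (Equivalence.from T-≡ (trans (sym (lookup∘tabulate _ w)) ([]=⇒lookup w∈)))

  rank : Fin n → ℕ
  rank v = ∣ below (f v) ∣

  rank-< : ∀ {u v} → f u < f v → rank u < rank v
  rank-< {u} fu<fv = p⊂q⇒∣p∣<∣q∣
    ( (λ w∈ → ∈-below⁺ (<-trans (∈-below⁻ w∈) fu<fv))
    , u , ∈-below⁺ fu<fv , (λ u∈ → <-irrefl refl (∈-below⁻ u∈)) )

  rank<n : ∀ v → rank v < n
  rank<n v = subst (rank v <_) (∣⊤∣≡n n)
    (p⊂q⇒∣p∣<∣q∣ (⊆⊤ , v , ∈⊤ , λ v∈ → <-irrefl refl (∈-below⁻ v∈)))

  rank-zero : ∀ {v} → f v ≡ 0 → rank v ≡ 0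
  rank-zero {v} fv≡0 = trans
    (cong ∣_∣ (Empty-unique λ (w , w∈) → n≮0 (subst (f w <_) fv≡0 (∈-below⁻ w∈))))
    (∣⊥∣≡0 n)

module _ {n : ℕ} {E : Graph n} {t : Fin n} where

  -- The position of the first visit of v (the length of the walk if v is never visited).
  firstVisit : ∀ {a} → WalkTo E t a → Fin n → ℕ
  firstVisit done v = 0
  firstVisit (step {u} _ W) v = if does (u ≟ v) then 0 else suc (firstVisit W v)

  -- The vertex from which the walk first enters v; nothing for its start and for unvisited vertices.
  entry : ∀ {a} → WalkTo E t a → Fin n → Maybe (Fin n)
  entry done v = nothing
  entry (step {u} {u′} _ W) v =
    if does (u ≟ v) then nothing else if does (u′ ≟ v) then just u else entry W v

  firstVisit-start : ∀ {a} (W : WalkTo E t a) → firstVisit W a ≡ 0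
  firstVisit-start done = refl
  firstVisit-start (step {u} _ W) rewrite dec-true (u ≟ u) refl = refl

  firstVisit-step-≤ : ∀ {u u′} (uu′ : Edge E u u′) (W : WalkTo E t u′) v →
    firstVisit (step uu′ W) v ≤ suc (firstVisit W v)
  firstVisit-step-≤ {u} _ W v with u ≟ v
  ... | yes _ = z≤n
  ... | no _ = ≤-refl

  entry-sound : ∀ {a} (W : WalkTo E t a) {p v} → entry W v ≡ just p →
    Edge E p v × 0 < traversals W p v × firstVisit W p < firstVisit W v
  entry-sound done ()
  entry-sound (step {u} {u′} uu′ W) {p} {v} eq with u ≟ v | u′ ≟ v
  entry-sound (step uu′ W) () | yes _ | _
  entry-sound (step {u} {u′} uu′ W) refl | no _ | yes refl
    rewrite dec-true (u ≟ u) refl = uu′ , s≤s z≤n , s≤s z≤n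
  ... | no _ | no _ with entry-sound W eq
  ...   | pv , traversed , earlier =
    pv , ≤-trans traversed (m≤n+m _ _) , ≤-<-trans (firstVisit-step-≤ uu′ W p) (s≤s earlier)

  traversed⇒entry : ∀ {a} (W : WalkTo E t a) {u v} → 0 < traversals W u v → a ≢ v →
    ∃ λ p → entry W v ≡ just p
  traversed⇒entry done () _
  traversed⇒entry (step {a} {b} _ W) {u} {v} traversed a≢v with a ≟ v | b ≟ v | a ≟ u
  ... | yes a≡v | _        | _     = contradiction a≡v a≢v
  ... | no _    | yes refl | _     = a , refl
  ... | no _    | no b≢v   | yes _ = traversed⇒entry W traversed b≢v
  ... | no _    | no b≢v   | no _  = traversed⇒entry W traversed b≢v

module _ {n : ℕ} (E : Graph n) where

  onEdges-edge : ∀ (f : Fin n → Fin n → ℕ) {u v} → Edge E u v → onEdges E f u v ≡ f u v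
  onEdges-edge f uv rewrite uv = refl

  onEdges-≤ : ∀ (f : Fin n → Fin n → ℕ) u v → onEdges E f u v ≤ f u v
  onEdges-≤ f u v with E u v
  ... | true = ≤-refl
  ... | false = z≤n

  ≤-inSum : ∀ (f : Fin n → Fin n → ℕ) {u v} → Edge E u v → f u v ≤ inSum E f v
  ≤-inSum f {u} {v} uv =
    subst (_≤ inSum E f v) (onEdges-edge f uv) (term≤∑ (λ w → onEdges E f w v) u)

  ≤-outSum : ∀ (f : Fin n → Fin n → ℕ) {u v} → Edge E u v → f u v ≤ outSum E f u
  ≤-outSum f {u} {v} uv =
    subst (_≤ outSum E f u) (onEdges-edge f uv) (term≤∑ (λ w → onEdges E f u w) v)

  inSum-positive : ∀ (f : Fin n → Fin n → ℕ) {v} → 0 < inSum E f v →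
    ∃ λ u → Edge E u v × 0 < f u v
  inSum-positive f {v} inflow with ∑-positive inflow
  ... | u , positive with E u v in uv
  ...   | true = u , uv , positive
  ...   | false = contradiction positive n≮0

  outSum-sink : ∀ {f : Fin n → Fin n → ℕ} {t} → ¬ HasOut E t → outSum E f t ≡ 0
  outSum-sink {f} {t} sink = ∑-zero nonEdge
    where
    nonEdge : ∀ w → onEdges E f t w ≡ 0
    nonEdge w with E t w in tw
    ... | true = contradiction (w , tw) sink
    ... | false = refl

  UnitFlow : (Fin n → Fin n → ℕ) → Fin n → Fin n → Set
  UnitFlow x a t = ∀ v → inSum E x v + δ a v ≡ outSum E x v + δ t v

  EnteredFromBelow : (Fin n → ℕ) → (Fin n → Fin n → ℕ) → Fin n → Set
  EnteredFromBelow d x v = 0 < inSum E x v → ∃ λ p → Edge E p v × 0 < x p v × d p < d v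

  Realises : ∀ {t a} → WalkTo E t a → (Fin n → Fin n → ℕ) → Set
  Realises W x = ∀ u v → Edge E u v → traversals W u v ≡ x u v

  Realisable : (Fin n → Fin n → ℕ) → Fin n → Fin n → Set
  Realisable x a t = Σ (WalkTo E t a) λ W → Realises W x

  total : (Fin n → Fin n → ℕ) → ℕ
  total x = ∑ (inSum E x)

  -- By induction on d v: the lower entry p of a vertex v with inflow has no inflow, hence no
  -- outflow, yet x p v > 0.
  circulation-vanishes : ∀ {d x} → (∀ v → inSum E x v ≡ outSum E x v) →
    (∀ v → EnteredFromBelow d x v) → ∀ v → inSum E x v ≡ 0
  circulation-vanishes {d} {x} balanced entered v = vanishes (suc (d v)) v ≤-refl
    where
    vanishes : ∀ k v → d v < k → inSum E x v ≡ 0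
    vanishes (suc k) v dv<1+k with inSum E x v ≟ℕ 0
    ... | yes noInflow = noInflow
    ... | no inflow with entered v (n≢0⇒n>0 inflow)
    ...   | p , pv , positive , dp<dv = contradiction (<-≤-trans positive xpv≤0) n≮0
      where
      xpv≤0 : x p v ≤ 0
      xpv≤0 = ≤-trans (≤-outSum x pv) (≤-reflexive (trans (sym (balanced p))
                (vanishes k p (<-≤-trans dp<dv (s≤s⁻¹ dv<1+k)))))

  source-is-sink : ∀ {x a t} → UnitFlow x a t → inSum E x t ≡ 0 → a ≡ t
  source-is-sink {x} {a} {t} flow noInflow =
    𝟙-positive (a ≟ t) (subst (0 <_) (sym δat≡) (m≤n+m 1 (outSum E x t)))
    where
    δat≡ : δ a t ≡ outSum E x t + 1
    δat≡ = trans (cong (_+ δ a t) (sym noInflow))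
                 (trans (flow t) (cong (_+_ (outSum E x t)) (𝟙-yes (t ≟ t) refl)))

  realise-without-inflow : ∀ {d x a t} → UnitFlow x a t → (∀ v → EnteredFromBelow d x v) →
    inSum E x t ≡ 0 → Realisable x a t
  realise-without-inflow {x = x} {a} {t} flow entered noInflow
    with source-is-sink {x} {a} {t} flow noInflow
  ... | refl = done , λ u v uv → sym (n≤0⇒n≡0 (≤-trans (≤-inSum x uv) (≤-reflexive (vanishes v))))
    where
    vanishes : ∀ v → inSum E x v ≡ 0
    vanishes = circulation-vanishes (λ v → +-cancelʳ-≡ (δ t v) _ _ (flow v)) entered

  decrement : Fin n → Fin n → (Fin n → Fin n → ℕ) → Fin n → Fin n → ℕ
  decrement c t x u v = x u v ∸ edgeδ c t u v

  module _ {x : Fin n → Fin n → ℕ} {c t : Fin n} (ct : Edge E c t) (x>0 : 0 < x c t) where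

    private
      x′ : Fin n → Fin n → ℕ
      x′ = decrement c t x

    decrement-split : ∀ u v → x u v ≡ x′ u v + edgeδ c t u v
    decrement-split u v with c ≟ u | t ≟ v
    ... | yes refl | yes refl = sym (m∸n+n≡m x>0)
    ... | yes _    | no _     = sym (+-identityʳ _)
    ... | no _     | _        = sym (+-identityʳ _)

    onEdges-decrement : ∀ u v → onEdges E x u v ≡ onEdges E x′ u v + edgeδ c t u v
    onEdges-decrement u v with E u v in uv
    ... | true = decrement-split u v
    ... | false with c ≟ u | t ≟ v
    ...   | yes refl | yes refl = contradiction (trans (sym ct) uv) λ ()
    ...   | yes _    | no _     = refl
    ...   | no _     | _        = refl

    inSum-decrement : ∀ v → inSum E x v ≡ inSum E x′ v + δ t v
    inSum-decrement v = trans (∑-cong (λ u → onEdges-decrement u v))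
      (trans (∑-distrib-+ (λ u → onEdges E x′ u v) (λ u → edgeδ c t u v))
             (cong (_+_ (inSum E x′ v)) (∑-edgeδ-head c t v)))

    outSum-decrement : ∀ v → outSum E x v ≡ outSum E x′ v + δ c v
    outSum-decrement v = trans (∑-cong (onEdges-decrement v))
      (trans (∑-distrib-+ (onEdges E x′ v) (edgeδ c t v))
             (cong (_+_ (outSum E x′ v)) (∑-edgeδ-tail c t v)))

    inSum-decrement-off : ∀ {v} → v ≢ t → inSum E x′ v ≡ inSum E x v
    inSum-decrement-off {v} v≢t = sym (trans (inSum-decrement v)
      (trans (cong (_+_ (inSum E x′ v)) (𝟙-no (t ≟ v) (v≢t ∘ sym))) (+-identityʳ _)))

    total-decrement : total x ≡ suc (total x′)
    total-decrement = trans (∑-cong inSum-decrement)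
      (trans (∑-distrib-+ (inSum E x′) (δ t))
             (trans (cong (_+_ (total x′)) (∑-δ t 1)) (+-comm _ 1)))

    unitFlow-decrement : ∀ {a} → UnitFlow x a t → UnitFlow x′ a c
    unitFlow-decrement {a} flow v =
      +-cancelʳ-≡ (δ t v) (inSum E x′ v + δ a v) (outSum E x′ v + δ c v) (begin
        inSum E x′ v + δ a v + δ t v
          ≡⟨ xy∙z≈xz∙y +-commutativeSemigroup (inSum E x′ v) (δ a v) (δ t v) ⟩
        inSum E x′ v + δ t v + δ a v  ≡⟨ cong (_+ δ a v) (sym (inSum-decrement v)) ⟩
        inSum E x v + δ a v           ≡⟨ flow v ⟩
        outSum E x v + δ t v          ≡⟨ cong (_+ δ t v) (outSum-decrement v) ⟩
        outSum E x′ v + δ c v + δ t v ∎)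
      where open ≡-Reasoning

    entered-decrement : ∀ {d} → (∀ v → EnteredFromBelow d x v) → EnteredFromBelow d x′ t →
      ∀ v → EnteredFromBelow d x′ v
    entered-decrement entered enteredAtT v with v ≟ t
    ... | yes refl = enteredAtT
    ... | no v≢t = λ inflow →
      let (p , pv , positive , dp<dv) = entered v (subst (0 <_) (inSum-decrement-off v≢t) inflow)
      in p , pv , subst (0 <_) (sym (cong (x p v ∸_) (edgeδ-off-head c p (v≢t ∘ sym)))) positive , dp<dv

  -- Use an edge into t other than the lower entry pt when there is one, so that pt survives;
  -- otherwise pt is the only edge into t left carrying flow.
  removable-entry : ∀ {d x t} → EnteredFromBelow d x t → 0 < inSum E x t →
    ∃ λ c → Edge E c t × 0 < x c t × EnteredFromBelow d (decrement c t x) t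
  removable-entry {d} {x} {t} entered inflow with entered inflow
  ... | p , pt , positive , dp<dt
      with any? (λ c → (E c t ≟ᵇ true) ×-dec (0 <? x c t) ×-dec ¬? (c ≟ p))
  ...   | yes (c , ct , cpositive , c≢p) = c , ct , cpositive , λ _ →
          p , pt , subst (0 <_) (sym (cong (x p t ∸_) (edgeδ-off-tail t t c≢p))) positive , dp<dt
  ...   | no onlyP = p , pt , positive , λ inflow′ →
          enteredVia (inSum-positive (decrement p t x) inflow′)
    where
    enteredVia : (∃ λ c → Edge E c t × 0 < decrement p t x c t) →
      ∃ λ q → Edge E q t × 0 < decrement p t x q t × d q < d t
    enteredVia (c , ct , cpositive) with c ≟ p
    ... | yes refl = p , pt , cpositive , dp<dt
    ... | no c≢p =
      contradiction (c , ct , <-≤-trans cpositive (m∸n≤m (x c t) (edgeδ p t c t)) , c≢p) onlyP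

  snoc : ∀ {a c t} → WalkTo E c a → Edge E c t → WalkTo E t a
  snoc done ct = step ct done
  snoc (step ab W) ct = step ab (snoc W ct)

  traversals-snoc : ∀ {a c t} (W : WalkTo E c a) (ct : Edge E c t) u v →
    traversals (snoc W ct) u v ≡ traversals W u v + edgeδ c t u v
  traversals-snoc {c = c} {t} done ct u v = +-comm (edgeδ c t u v) 0
  traversals-snoc (step {a} {b} ab W) ct u v =
    trans (cong (_+_ (edgeδ a b u v)) (traversals-snoc W ct u v))
          (sym (+-assoc (edgeδ a b u v) _ _))

  realises-snoc : ∀ {x a c t} {W : WalkTo E c a} (ct : Edge E c t) (x>0 : 0 < x c t) →
    Realises W (decrement c t x) → Realises (snoc W ct) x
  realises-snoc {c = c} {t} {W} ct x>0 W≡x′ u v uv = trans (traversals-snoc W ct u v)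
    (trans (cong (_+ edgeδ c t u v) (W≡x′ u v uv)) (sym (decrement-split ct x>0 u v)))

  realise-by : ∀ {d} k {x a t} → total x ≡ k → UnitFlow x a t →
    (∀ v → EnteredFromBelow d x v) → Realisable x a t
  realise-by k {x} {t = t} _ flow entered with inSum E x t ≟ℕ 0
  ... | yes noInflow = realise-without-inflow flow entered noInflow
  realise-by zero {x} {t = t} total≡0 _ _ | no inflow =
    contradiction (n≤0⇒n≡0 (subst (inSum E x t ≤_) total≡0 (term≤∑ (inSum E x) t))) inflow
  realise-by {d} (suc k) {x} {a} {t} total≡1+k flow entered | no inflow
      with removable-entry {d} {x} {t} (entered t) (n≢0⇒n>0 inflow)
  ... | c , ct , x>0 , enteredAtT
      with realise-by k {decrement c t x} {a} {c}
             (suc-injective (trans (sym (total-decrement {x} ct x>0)) total≡1+k))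
             (unitFlow-decrement {x} ct x>0 {a} flow)
             (entered-decrement {x} ct x>0 entered enteredAtT)
  ...   | W , W≡x′ = snoc W ct , realises-snoc {x} {W = W} ct x>0 W≡x′

  realise : ∀ {d x a t} → UnitFlow x a t → (∀ v → EnteredFromBelow d x v) → Realisable x a t
  realise = realise-by _ refl

  flowDemand-source : ∀ (s t : Fin n) → flowDemand s t s ≡ + 0 - + 1
  flowDemand-source s t rewrite dec-true (s ≟ s) refl = refl

  flowDemand-δ : ∀ {s t v : Fin n} → s ≢ t → flowDemand s t v ≡ + δ t v - + δ s v
  flowDemand-δ {s} {t} {v} s≢t with v ≟ s | v ≟ t
  ... | yes refl | _
      rewrite dec-false (t ≟ v) (s≢t ∘ sym) | dec-true (v ≟ v) refl = refl
  ... | no v≢s | yes refl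
      rewrite dec-true (v ≟ v) refl | dec-false (s ≟ v) (v≢s ∘ sym) = refl
  ... | no v≢s | no v≢t
      rewrite dec-false (t ≟ v) (v≢t ∘ sym) | dec-false (s ≟ v) (v≢s ∘ sym) = refl

  unitFlow-of-demand : ∀ {s t x} → ¬ HasOut E t →
    (∀ v → (+ inSum E x v) - (+ outSum E x v) ≡ flowDemand s t v) → UnitFlow x s t
  unitFlow-of-demand {s} {t} {x} sink demand v =
    i-o≡k-m⇒i+m≡o+k _ _ (δ t v) (δ s v) (trans (demand v) (flowDemand-δ {s} {t} {v} s≢t))
    where
    s≢t : s ≢ t
    s≢t refl = 1+n≢0 (begin
      suc (inSum E x s)    ≡⟨ +-comm 1 _ ⟩
      inSum E x s + 1      ≡⟨ i-o≡k-m⇒i+m≡o+k _ _ 0 1 (trans (demand s) (flowDemand-source s s)) ⟩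
      outSum E x s + 0     ≡⟨ +-identityʳ _ ⟩
      outSum E x s         ≡⟨ outSum-sink {x} sink ⟩
      0                    ∎)
      where open ≡-Reasoning

  enteredFromBelow-of-marks : ∀ {x y d M₁ M₂} →
    (∀ u v → Edge E u v → y u v ≤ 1) → (∀ u v → Edge E u v → y u v ≤ x u v) →
    (∀ v → inSum E x v ≤ M₁ * inSum E y v) →
    (∀ u v → Edge E u v → (+ d u) +ℤ + 1 - (+ M₂) *ℤ (+ 1 - + y u v) ≤ℤ + d v) →
    ∀ v → EnteredFromBelow d x v
  enteredFromBelow-of-marks {x} {y} {d} {M₁} {M₂} y≤1 y≤x x≤M₁y ordered v inflow
    with inSum-positive y (bigM-support⁻ M₁ (x≤M₁y v) inflow)
  ... | p , pv , y>0 = p , pv , <-≤-trans y>0 (y≤x p v pv) , bigM-active⁻ {M = M₂} orderedAt-pv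
    where
    orderedAt-pv : (+ d p) +ℤ + 1 - (+ M₂) *ℤ (+ 1 - + 1) ≤ℤ + d v
    orderedAt-pv = subst (λ k → (+ d p) +ℤ + 1 - (+ M₂) *ℤ (+ 1 - + k) ≤ℤ + d v)
                         (≤-antisym (y≤1 p v pv) y>0) (ordered p v pv)

  module _ {s t : Fin n} (W : WalkTo E t s) where

    entryMarks : Fin n → Fin n → ℕ
    entryMarks u v = 𝟙 (entry W v ≟ₘ just u)

    potential : Fin n → ℕ
    potential = rank (firstVisit W)

    potential-start : potential s ≡ 0
    potential-start = rank-zero (firstVisit W) (firstVisit-start W)

    entryMarks≤1 : ∀ u v → entryMarks u v ≤ 1
    entryMarks≤1 u v = 𝟙≤1 (entry W v ≟ₘ just u)

    entryMarks≤traversals : ∀ u v → entryMarks u v ≤ traversals W u v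
    entryMarks≤traversals u v = 𝟙≤ (entry W v ≟ₘ just u) (λ eq → proj₁ (proj₂ (entry-sound W eq)))

    inSum-entryMarks≤1 : ∀ v → inSum E entryMarks v ≤ 1
    inSum-entryMarks≤1 v =
      ≤-trans (∑-mono (λ u → onEdges-≤ entryMarks u v)) (∑-𝟙-just (entry W v))

    inflow⇒entryMarked : ∀ {x v} → Realises W x → ¬ HasIn E s →
      0 < inSum E x v → 0 < inSum E entryMarks v
    inflow⇒entryMarked {x} {v} W≡x source inflow with inSum-positive x inflow
    ... | u , uv , x>0
        with traversed⇒entry W (subst (0 <_) (sym (W≡x u v uv)) x>0) (λ { refl → source (u , uv) })
    ...   | p , eq = ≤-trans (≤-reflexive (sym (𝟙-yes (entry W v ≟ₘ just p) eq)))
                             (≤-inSum entryMarks (proj₁ (entry-sound W eq)))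

    entryMarks-potential : ∀ {M} → n ≤ M → ∀ u v →
      (+ potential u) +ℤ + 1 - (+ M) *ℤ (+ 1 - + entryMarks u v) ≤ℤ + potential v
    entryMarks-potential {M} n≤M u v with entry W v ≟ₘ just u
    ... | yes eq = bigM-active⁺ {M = M} (rank-< (firstVisit W) (proj₂ (proj₂ (entry-sound W eq))))
    ... | no _ = bigM-inactive (<-≤-trans (rank<n (firstVisit W) u) n≤M)

theoremA2 : (n : ℕ) (E : Graph n) (s t : Fin n) → IsSTGraph E s t →
    (x : Fin n → Fin n → ℕ) →
    (∀ v → (+ inSum E x v) - (+ outSum E x v)
             ≡ flowDemand s t v) →
    (M₁ M₂ : ℕ) → (∀ v → inSum E x v ≤ M₁) → n ≤ M₂ →
    (Σ (WalkTo E t s) (λ W → ∀ u v → Edge E u v → traversals W u v ≡ x u v))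
    ⇔
    (Σ (Fin n → Fin n → ℕ) λ y → Σ (Fin n → ℕ) λ d →
        d s ≡ 0
      × (∀ u v → Edge E u v → y u v ≤ 1)
      × (∀ u v → Edge E u v → y u v ≤ x u v)
      × (∀ v → inSum E x v ≤ M₁ * inSum E y v)
      × (∀ v → inSum E y v ≤ 1)
      × (∀ u v → Edge E u v →
           (+ d u) +ℤ + 1 - (+ M₂) *ℤ (+ 1 - + y u v) ≤ℤ + d v))
theoremA2 n E s t st x demand M₁ M₂ inflow≤M₁ n≤M₂ = mk⇔
  (λ (W , W≡x) →
      entryMarks E W , potential E W , potential-start E W
    , (λ u v _ → entryMarks≤1 E W u v)
    , (λ u v uv → subst (_ ≤_) (W≡x u v uv) (entryMarks≤traversals E W u v))
    , (λ v → bigM-support⁺ (inflow≤M₁ v) (inflow⇒entryMarked E W W≡x s-source))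
    , inSum-entryMarks≤1 E W
    , (λ u v _ → entryMarks-potential E W n≤M₂ u v))
  (λ (y , d , _ , y≤1 , y≤x , x≤M₁y , _ , ordered) →
      realise E (unitFlow-of-demand E t-sink demand)
        (enteredFromBelow-of-marks E {M₁ = M₁} {M₂} y≤1 y≤x x≤M₁y ordered))
  where open IsSTGraph st
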